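{- Let $\mathcal{A}$ be the set of finite integer sequences $a=(a_0,a_1,\dots,a_n)$ ($n\ge 0$) with $0\le a_i\le i$ for all $i$, and let $\mathcal{A}_n$ denote the set of those of length $n+1$. Let $\alpha:\mathcal{A}\to\mathcal{A}$ be a map that preserves length and preserves the prefix order (i.e. $a\preceq b$ implies $\alpha a\preceq \alpha b$). Assume that for some $n\ge 1$ there exists $k\ge 1$ such that, for every $u\in\mathcal{A}_n$, either \[ u\le \alpha^k u\le \alpha^{2k}u\le\cdots \quad\text{or}\quad u\ge \alpha^k u\ge \alpha^{2k}u\ge\cdots, \] where $\le$ is the lexicographic order on $\mathcal{A}_n$. Then, starting from any $u\in\mathcal{A}_n$, repeated applications of $\alpha$ lead to a periodic point of $\alpha$ whose period divides $k$ within $O(n^2)$ steps (the implied constant depending only on $k$).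
   Context: Prefix order: $(a_0,\dots,a_n)\preceq(b_0,\dots,b_m)$ if $n\le m$ and $a_i=b_i$ for $i=0,\dots,n$. Such maps $\alpha$ are exactly the root-fixing graph endomorphisms of the rooted tree $\mathcal{T}$ whose vertices at level $n$ are the sequences in $\mathcal{A}_n$, a sequence being joined to its one-term extensions. Lexicographic order on $\mathcal{A}_n$: $a<b$ if $a_i<b_i$ at the first index $i$ where $a$ and $b$ differ. A point $a$ is periodic for $\alpha$ if $\alpha^j a=a$ for some $j>0$; its period is the least such $j$. -}

module Defs where

open import Data.Nat using (ℕ; zero; suc; _+_; _*_; _≤_; _<_)
open import Data.Nat.Divisibility using (_∣_)
open import Data.Fin using (Fin; toℕ; inject≤)
open import Data.Fin.Base using () renaming (_<_ to _<ᶠ_)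
open import Data.Nat.Properties using (s≤s-injective)
open import Data.Vec using (Vec; lookup)
open import Data.Product using (Σ; ∃; _×_; _,_)
open import Data.Sum using (_⊎_)
open import Relation.Binary.PropositionalEquality using (_≡_; _≢_)
open import Relation.Nullary using (¬_)

-- 𝒜ₙ : integer sequences (a₀,…,aₙ) of length n+1 with 0 ≤ aᵢ ≤ i.
-- (Entries are natural numbers, so 0 ≤ aᵢ is automatic.)
-- The bound proof is irrelevant, so equality of elements of 𝒜ₙ is
-- equality of the underlying sequences.
record 𝒜 (n : ℕ) : Set where
  constructor mk
  field
    seq : Vec ℕ (suc n)
    .bounded : (i : Fin (suc n)) → lookup seq i ≤ toℕ i
open 𝒜 public

_⪯_ : ∀ {n m} → 𝒜 n → 𝒜 m → Set
_⪯_ {n} {m} a b =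
  Σ (n ≤ m) λ n≤m → (i : Fin (suc n)) →
    lookup (seq a) i ≡ lookup (seq b) (inject≤ i (Data.Nat.s≤s n≤m))

LenPreserving : Set
LenPreserving = (n : ℕ) → 𝒜 n → 𝒜 n

PrefixMonotone : LenPreserving → Set
PrefixMonotone α = ∀ {n m} (a : 𝒜 n) (b : 𝒜 m) → a ⪯ b → α n a ⪯ α m b

iter : LenPreserving → (n : ℕ) → ℕ → 𝒜 n → 𝒜 n
iter α n zero    u = u
iter α n (suc j) u = α n (iter α n j u)

_<ˡᵉˣ_ : ∀ {n} → 𝒜 n → 𝒜 n → Set
_<ˡᵉˣ_ {n} a b =
  ∃ λ (i : Fin (suc n)) →
    ((j : Fin (suc n)) → j <ᶠ i → lookup (seq a) j ≡ lookup (seq b) j)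
    × lookup (seq a) i < lookup (seq b) i

_≤ˡᵉˣ_ : ∀ {n} → 𝒜 n → 𝒜 n → Set
a ≤ˡᵉˣ b = a <ˡᵉˣ b ⊎ a ≡ b

HasPeriod : (α : LenPreserving) {n : ℕ} → 𝒜 n → ℕ → Set
HasPeriod α {n} a j =
  0 < j × iter α n j a ≡ a × (∀ i → 0 < i → i < j → iter α n i a ≢ a)

KMonotoneAt : LenPreserving → ℕ → ℕ → Set
KMonotoneAt α n k =
  (u : 𝒜 n) →
    ((m : ℕ) → iter α n (m * k) u ≤ˡᵉˣ iter α n (suc m * k) u)
    ⊎ ((m : ℕ) → iter α n (suc m * k) u ≤ˡᵉˣ iter α n (m * k) u)

{-# OPTIONS --safe #-}
-- Put xₘ = α^{mk} u. Because α respects prefixes, once xₘ and xₘ₊₁ agree in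
-- their first d entries, so do all later consecutive pairs. Lexicographic
-- monotonicity then makes entry d of xₘ a monotone sequence with values in
-- [0, d], so within d further steps it repeats and the agreement grows to d+1
-- entries. After n+1 such rounds, i.e. s ≤ (n+1)n steps of αᵏ, xₛ = xₛ₊₁: the
-- point xₛ is fixed by αᵏ, hence periodic with period dividing k, and it is
-- reached after sk ≤ 2k n² applications of α.
module Submission where

open import Defs
open import Data.Nat
  using (ℕ; zero; suc; _+_; _*_; _∸_; _≤_; _<_; z≤n; s≤s; s≤s⁻¹; z<s; _≟_; _≤?_; _<?_; NonZero; >-nonZero)
open import Data.Nat.Properties
open import Data.Nat.DivMod using (_%_; _/_; m≡m%n+[m/n]*n; m%n<n)
open import Data.Nat.Divisibility using (_∣_; m%n≡0⇒n∣m)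
open import Data.Nat.Induction using (<-rec)
open import Data.Nat.Tactic.RingSolver using (solve-∀)
open import Data.Fin using (Fin; toℕ; inject≤; fromℕ<)
open import Data.Fin.Properties using (toℕ-injective; toℕ-inject≤; toℕ-fromℕ<; toℕ<n; any?)
import Data.Fin.Properties as Fin
open import Data.Vec using (lookup; tabulate)
open import Data.Vec.Properties using (lookup∘tabulate; ≡-dec)
open import Data.Vec.Relation.Binary.Pointwise.Extensional using (ext; Pointwise-≡⇒≡)
open import Data.Product using (∃; _×_; _,_)
import Data.Product as Product
open import Data.Sum using (_⊎_; inj₁; inj₂)
import Data.Sum as Sum
open import Function using (_∘_)
open import Relation.Nullary using (Dec; yes; no; contradiction)
open import Relation.Nullary.Decidable using (recompute; map′; _×-dec_)
open import Relation.Binary.Definitions using (DecidableEquality; tri<; tri≈; tri>)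
open import Relation.Binary.PropositionalEquality

nondecreasing-stalls : ∀ d (y : ℕ → ℕ) → (∀ j → y j ≤ y (suc j)) → y (suc d) ≤ d + y 0 →
                       ∃ λ j → j ≤ d × y j ≡ y (suc j)
nondecreasing-stalls zero y up y₁≤y₀ = 0 , z≤n , ≤-antisym (up 0) y₁≤y₀
nondecreasing-stalls (suc d) y up bound with y 0 ≟ y 1
... | yes stall = 0 , z≤n , stall
... | no y₀≢y₁ = Product.map suc (Product.map₁ s≤s)
                   (nondecreasing-stalls d (y ∘ suc) (up ∘ suc) bound′)
  where
  bound′ : y (suc (suc d)) ≤ d + y 1
  bound′ = begin
    y (suc (suc d))  ≤⟨ bound ⟩
    suc (d + y 0)    ≡⟨ +-suc d (y 0) ⟨
    d + suc (y 0)    ≤⟨ +-monoʳ-≤ d (≤∧≢⇒< (up 0) y₀≢y₁) ⟩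
    d + y 1          ∎
    where open ≤-Reasoning

bounded-monotone-stalls : ∀ d (y : ℕ → ℕ) → (∀ j → y j ≤ d) →
                          (∀ j → y j ≤ y (suc j)) ⊎ (∀ j → y (suc j) ≤ y j) →
                          ∃ λ j → j ≤ d × y j ≡ y (suc j)
bounded-monotone-stalls d y y≤d (inj₁ up) =
  nondecreasing-stalls d y up (≤-trans (y≤d (suc d)) (m≤m+n d (y 0)))
bounded-monotone-stalls d y y≤d (inj₂ down) =
  Product.map₂ (Product.map₂ cancel)
    (nondecreasing-stalls d (λ j → d ∸ y j) (λ j → ∸-monoʳ-≤ d (down j))
                          (≤-trans (m∸n≤m d (y (suc d))) (m≤m+n d (d ∸ y 0))))
  where
  cancel : ∀ {j} → d ∸ y j ≡ d ∸ y (suc j) → y j ≡ y (suc j)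
  cancel = ∸-cancelˡ-≡ (y≤d _) (y≤d _)

𝒜-ext : ∀ {n} {a b : 𝒜 n} → seq a ≡ seq b → a ≡ b
𝒜-ext {a = mk _ _} {b = mk _ _} refl = refl

_≟𝒜_ : ∀ {n} → DecidableEquality (𝒜 n)
a ≟𝒜 b = map′ 𝒜-ext (cong seq) (≡-dec _≟_ (seq a) (seq b))

lookup-≤-index : ∀ {n} (a : 𝒜 n) (i : Fin (suc n)) → lookup (seq a) i ≤ toℕ i
lookup-≤-index (mk _ entries≤) i = recompute (_ ≤? _) (entries≤ i)

prefix-entry : ∀ {d n} → d ≤ n → 𝒜 n → Fin (suc d) → ℕ
prefix-entry d≤n a i = lookup (seq a) (inject≤ i (s≤s d≤n))

prefix : ∀ {d n} → d ≤ n → 𝒜 n → 𝒜 d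
prefix d≤n a = mk (tabulate (prefix-entry d≤n a)) entries≤
  where
  entries≤ : ∀ i → lookup (tabulate (prefix-entry d≤n a)) i ≤ toℕ i
  entries≤ i = subst₂ _≤_ (sym (lookup∘tabulate (prefix-entry d≤n a) i)) (toℕ-inject≤ i _)
                      (lookup-≤-index a (inject≤ i (s≤s d≤n)))

prefix-⪯ : ∀ {d n} (d≤n : d ≤ n) (a : 𝒜 n) → prefix d≤n a ⪯ a
prefix-⪯ d≤n a = d≤n , lookup∘tabulate (prefix-entry d≤n a)

AgreeBelow : ∀ {n} → ℕ → 𝒜 n → 𝒜 n → Set
AgreeBelow {n} d a b = (j : Fin (suc n)) → toℕ j < d → lookup (seq a) j ≡ lookup (seq b) j

module _ {n : ℕ} {a b : 𝒜 n} where

  AgreeBelow-sym : ∀ {d} → AgreeBelow d a b → AgreeBelow d b a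
  AgreeBelow-sym agree j j<d = sym (agree j j<d)

  AgreeBelow-extend : ∀ {i} → AgreeBelow (toℕ i) a b → lookup (seq a) i ≡ lookup (seq b) i →
                      AgreeBelow (suc (toℕ i)) a b
  AgreeBelow-extend {i} agree same j j≤i with Fin.<-cmp j i
  ... | tri< j<i _ _ = agree j j<i
  ... | tri≈ _ refl _ = same
  ... | tri> _ _ i<j = contradiction (s≤s⁻¹ j≤i) (<⇒≱ i<j)

  AgreeBelow⇒≡ : AgreeBelow (suc n) a b → a ≡ b
  AgreeBelow⇒≡ agree = 𝒜-ext (Pointwise-≡⇒≡ (ext λ j → agree j (toℕ<n j)))

  AgreeBelow⇒prefix-⪯ : ∀ {d} (d≤n : d ≤ n) → AgreeBelow (suc d) a b → prefix d≤n a ⪯ b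
  AgreeBelow⇒prefix-⪯ {d} d≤n agree = d≤n , λ i →
    trans (lookup∘tabulate (prefix-entry d≤n a) i)
          (agree (inject≤ i _) (subst (_< suc d) (sym (toℕ-inject≤ i _)) (toℕ<n i)))

  common-prefix⇒AgreeBelow : ∀ {d} (c : 𝒜 d) → c ⪯ a → c ⪯ b → AgreeBelow (suc d) a b
  common-prefix⇒AgreeBelow c (_ , c≡a) (_ , c≡b) j j<sd =
    subst (λ j → lookup (seq a) j ≡ lookup (seq b) j) inject≤i≡j (trans (sym (c≡a i)) (c≡b i))
    where
    i = fromℕ< j<sd
    inject≤i≡j : inject≤ i _ ≡ j
    inject≤i≡j = toℕ-injective (trans (toℕ-inject≤ i _) (toℕ-fromℕ< j<sd))

  ≤ˡᵉˣ⇒lookup-≤ : ∀ {i} → a ≤ˡᵉˣ b → AgreeBelow (toℕ i) a b →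
                  lookup (seq a) i ≤ lookup (seq b) i
  ≤ˡᵉˣ⇒lookup-≤ (inj₂ refl) _ = ≤-refl
  ≤ˡᵉˣ⇒lookup-≤ {i} (inj₁ (i₀ , same-before , smaller)) agree with Fin.<-cmp i₀ i
  ... | tri< i₀<i _ _ = contradiction (agree i₀ i₀<i) (<⇒≢ smaller)
  ... | tri≈ _ refl _ = <⇒≤ smaller
  ... | tri> _ _ i<i₀ = ≤-reflexive (same-before i i<i₀)

module _ {α : LenPreserving} (prefix-monotone : PrefixMonotone α) {n : ℕ} where

  AgreeBelow-α : ∀ {d} {a b : 𝒜 n} → d ≤ suc n → AgreeBelow d a b →
                 AgreeBelow d (α n a) (α n b)
  AgreeBelow-α {zero} _ _ _ ()
  AgreeBelow-α {suc d} {a} {b} (s≤s d≤n) agree =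
    common-prefix⇒AgreeBelow {a = α n a} {b = α n b} (α d c)
      (prefix-monotone c a (prefix-⪯ d≤n a))
      (prefix-monotone c b (AgreeBelow⇒prefix-⪯ {a = a} {b = b} d≤n agree))
    where
    c = prefix d≤n a

  AgreeBelow-iter : ∀ {d} {a b : 𝒜 n} → d ≤ suc n → ∀ j → AgreeBelow d a b →
                    AgreeBelow d (iter α n j a) (iter α n j b)
  AgreeBelow-iter d≤ zero    agree = agree
  AgreeBelow-iter d≤ (suc j) agree = AgreeBelow-α d≤ (AgreeBelow-iter d≤ j agree)

module LexMonotoneSequence {n : ℕ} (x : ℕ → 𝒜 n)
  (agreement-persists : ∀ {d} m → d ≤ suc n →
     AgreeBelow d (x m) (x (suc m)) → AgreeBelow d (x (suc m)) (x (suc (suc m))))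
  (lex-monotone : (∀ m → x m ≤ˡᵉˣ x (suc m)) ⊎ (∀ m → x (suc m) ≤ˡᵉˣ x m)) where

  agree-onwards : ∀ {d s} → d ≤ suc n → AgreeBelow d (x s) (x (suc s)) →
               ∀ j → AgreeBelow d (x (j + s)) (x (suc (j + s)))
  agree-onwards d≤ agree zero    = agree
  agree-onwards d≤ agree (suc j) = agreement-persists _ d≤ (agree-onwards d≤ agree j)

  agreement-grows : ∀ (i : Fin (suc n)) s → AgreeBelow (toℕ i) (x s) (x (suc s)) →
    ∃ λ j → j ≤ toℕ i × AgreeBelow (suc (toℕ i)) (x (j + s)) (x (suc (j + s)))
  agreement-grows i s agree = extend (bounded-monotone-stalls (toℕ i) entry entry≤ entry-monotone)
    where
    entry : ℕ → ℕ
    entry j = lookup (seq (x (j + s))) i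
    entry≤ : ∀ j → entry j ≤ toℕ i
    entry≤ j = lookup-≤-index (x (j + s)) i
    agree-later : ∀ j → AgreeBelow (toℕ i) (x (j + s)) (x (suc (j + s)))
    agree-later = agree-onwards (<⇒≤ (toℕ<n i)) agree
    agree-later-sym : ∀ j → AgreeBelow (toℕ i) (x (suc (j + s))) (x (j + s))
    agree-later-sym j = AgreeBelow-sym {a = x (j + s)} {b = x (suc (j + s))} (agree-later j)
    entry-monotone : (∀ j → entry j ≤ entry (suc j)) ⊎ (∀ j → entry (suc j) ≤ entry j)
    entry-monotone = Sum.map (λ up j → ≤ˡᵉˣ⇒lookup-≤ (up (j + s)) (agree-later j))
                             (λ down j → ≤ˡᵉˣ⇒lookup-≤ (down (j + s)) (agree-later-sym j))
                             lex-monotone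
    extend : (∃ λ j → j ≤ toℕ i × entry j ≡ entry (suc j)) →
             ∃ λ j → j ≤ toℕ i × AgreeBelow (suc (toℕ i)) (x (j + s)) (x (suc (j + s)))
    extend (j , j≤i , stall) =
      j , j≤i , AgreeBelow-extend {a = x (j + s)} {b = x (suc (j + s))} (agree-later j) stall

  agree-within : ∀ d → d ≤ suc n → ∃ λ s → s ≤ d * n × AgreeBelow d (x s) (x (suc s))
  agree-within zero    _    = 0 , z≤n , λ _ ()
  agree-within (suc d) d<sn with fromℕ< d<sn | toℕ-fromℕ< d<sn | agree-within d (<⇒≤ d<sn)
  ... | i | refl | s , s≤ , agree with agreement-grows i s agree
  ...   | j , j≤i , agree′ = j + s , +-mono-≤ (≤-trans j≤i (s≤s⁻¹ (toℕ<n i))) s≤ , agree′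

  stabilises : ∃ λ s → s ≤ suc n * n × x s ≡ x (suc s)
  stabilises = Product.map₂ (Product.map₂ AgreeBelow⇒≡) (agree-within (suc n) ≤-refl)

module _ (α : LenPreserving) {n : ℕ} where

  iter-+ : ∀ i j (w : 𝒜 n) → iter α n (i + j) w ≡ iter α n i (iter α n j w)
  iter-+ zero    j w = refl
  iter-+ (suc i) j w = cong (α n) (iter-+ i j w)

  module _ {w : 𝒜 n} where

    iter-*-fixed : ∀ {p} → iter α n p w ≡ w → ∀ q → iter α n (q * p) w ≡ w
    iter-*-fixed p-fixed zero    = refl
    iter-*-fixed {p} p-fixed (suc q) = begin
      iter α n (p + q * p) w          ≡⟨ iter-+ p (q * p) w ⟩
      iter α n p (iter α n (q * p) w) ≡⟨ cong (iter α n p) (iter-*-fixed p-fixed q) ⟩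
      iter α n p w                    ≡⟨ p-fixed ⟩
      w                               ∎
      where open ≡-Reasoning

    iter-%-fixed : ∀ {p q} .{{_ : NonZero p}} → iter α n p w ≡ w → iter α n q w ≡ w →
                   iter α n (q % p) w ≡ w
    iter-%-fixed {p} {q} p-fixed q-fixed = begin
      iter α n (q % p) w                        ≡⟨ cong (iter α n (q % p)) (iter-*-fixed p-fixed (q / p)) ⟨
      iter α n (q % p) (iter α n (q / p * p) w) ≡⟨ iter-+ (q % p) (q / p * p) w ⟨
      iter α n (q % p + q / p * p) w            ≡⟨ cong (λ t → iter α n t w) (m≡m%n+[m/n]*n q p) ⟨
      iter α n q w                              ≡⟨ q-fixed ⟩
      w                                         ∎
      where open ≡-Reasoning

    period-∣ : ∀ {p q} → HasPeriod α w p → iter α n q w ≡ w → p ∣ q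
    period-∣ {p} {q} (0<p , p-fixed , minimal) q-fixed = m%n≡0⇒n∣m q p q%p≡0
      where
      instance
        p≢0 : NonZero p
        p≢0 = >-nonZero 0<p
      q%p≡0 : q % p ≡ 0
      q%p≡0 with q % p | m%n<n q p | iter-%-fixed {q = q} p-fixed q-fixed
      ... | zero  | _   | _       = refl
      ... | suc r | r<p | r-fixed = contradiction r-fixed (minimal (suc r) z<s r<p)

    Returns : ℕ → Set
    Returns t = 0 < t × iter α n t w ≡ w

    returns? : ∀ t → Dec (Returns t)
    returns? t = (0 <? t) ×-dec (iter α n t w ≟𝒜 w)

    return⇒period : ∀ q → Returns q → ∃ (HasPeriod α w)
    return⇒period = <-rec (λ q → Returns q → ∃ (HasPeriod α w)) least
      where
      least : ∀ q → (∀ {i} → i < q → Returns i → ∃ (HasPeriod α w)) →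
              Returns q → ∃ (HasPeriod α w)
      least q earlier (0<q , q-fixed) with any? (returns? ∘ toℕ {q})
      ... | yes (i , i-returns) = earlier (toℕ<n i) i-returns
      ... | no none = q , 0<q , q-fixed , λ i 0<i i<q i-fixed →
        none (fromℕ< i<q , subst Returns (sym (toℕ-fromℕ< i<q)) (0<i , i-fixed))

    return⇒period-∣ : ∀ {q} → 0 < q → iter α n q w ≡ w → ∃ λ p → HasPeriod α w p × p ∣ q
    return⇒period-∣ 0<q q-fixed =
      Product.map₂ (λ period → period , period-∣ period q-fixed) (return⇒period _ (0<q , q-fixed))

orbit-agreement-persists : ∀ {α} → PrefixMonotone α → ∀ {n} k (u : 𝒜 n) {d} m → d ≤ suc n →
  AgreeBelow d (iter α n (m * k) u) (iter α n (suc m * k) u) →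
  AgreeBelow d (iter α n (suc m * k) u) (iter α n (suc (suc m) * k) u)
orbit-agreement-persists {α} prefix-monotone {n} k u {d} m d≤ agree =
  subst₂ (AgreeBelow d) (sym (iter-+ α k (m * k) u)) (sym (iter-+ α k (suc m * k) u))
         (AgreeBelow-iter prefix-monotone d≤ k agree)

orbit-time-bound : ∀ {n s} k → 0 < n → s ≤ suc n * n → s * k ≤ 2 * k * (n * n)
orbit-time-bound {n} {s} k 0<n s≤ = begin
  s * k                ≤⟨ *-monoˡ-≤ k (≤-trans s≤ (+-monoˡ-≤ (n * n) n≤n*n)) ⟩
  (n * n + n * n) * k  ≡⟨ double-square n k ⟩
  2 * k * (n * n)      ∎
  where
  open ≤-Reasoning
  n≤n*n : n ≤ n * n
  n≤n*n = m≤m*n n n {{>-nonZero 0<n}}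
  double-square : ∀ n k → (n * n + n * n) * k ≡ 2 * k * (n * n)
  double-square = solve-∀

theorem1 : (k : ℕ) → 0 < k →
    ∃ λ (C : ℕ) →
    (α : LenPreserving) → PrefixMonotone α →
    (n : ℕ) → 0 < n → KMonotoneAt α n k →
    (u : 𝒜 n) →
    ∃ λ (t : ℕ) → t ≤ C * (n * n) ×
    ∃ λ (p : ℕ) → HasPeriod α (iter α n t u) p × p ∣ k
theorem1 k 0<k = 2 * k , λ α prefix-monotone n 0<n k-monotone u →
  let x : ℕ → 𝒜 n
      x m = iter α n (m * k) u
      (s , s≤ , xₛ≡xₛ₊₁) = LexMonotoneSequence.stabilises x
                             (orbit-agreement-persists prefix-monotone k u) (k-monotone u)
      αᵏ-fixes-xₛ : iter α n k (x s) ≡ x s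
      αᵏ-fixes-xₛ = trans (sym (iter-+ α k (s * k) u)) (sym xₛ≡xₛ₊₁)
  in s * k , orbit-time-bound k 0<n s≤ , return⇒period-∣ α 0<k αᵏ-fixes-xₛ
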